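{- Let $G$ be a finite (directed or undirected) graph and $(p_v)_{v\in V(G)}$ a probability distribution on $V(G)$. If a vertex $v$ has shortest chase length $k>1$, then there is a vertex $u\in N(v)$ with $u\neq v$ such that $u$ has shortest chase length $k-1$ and $u$ follows $v$ in a shortest chase path starting at $v$ (in particular $T(v)=1+(1-p_v)T(u)$).
   Context: Game: $N(v)$ is the set consisting of $v$ and all $w$ with $(v,w)\in E(G)$. In each round the gambler independently chooses a vertex according to $(p_v)$; if it equals the cop's current vertex the cop wins, otherwise the cop moves to a vertex of $N(\text{current vertex})$. $T(v)$ is the optimal expected number of rounds until capture when the cop is at vertex $v$ at the start of a round (that round counted). Convention $1/0=+\infty$. A chase path is a sequence of vertices $(v_0,v_1,\dots,v_{m})$ such that $v_{j+1}\in N(v_j)$ and $T(v_j)=1+(1-p_{v_j})T(v_{j+1})$ for each $0\le j\le m-1$, and $T(v_m)=1+(1-p_{v_m})T(v_m)$. Its length is its number of vertices, $m+1$. A chase path starting at $v$ is a shortest chase path if no chase path starting at $v$ is shorter; $v$ has shortest chase length $k$ if a shortest chase path starting from $v$ has length $k$. In a chase path, $v_{j+1}$ follows $v_j$. -}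

module Defs where

open import Data.Nat using (ℕ; suc; _≤_)
open import Data.Fin using (Fin)
open import Data.List using (List; []; _∷_; length)
open import Data.Sum using (_⊎_)
open import Data.Product using (Σ; _×_)
open import Relation.Binary.PropositionalEquality using (_≡_)

-- Abstract value arithmetic: the (extended) numbers in which p_v and T(v)
-- live, with the operations 1, +, *, - needed to write T(v) = 1 + (1 - p_v) T(w).
record Arith : Set₁ where
  field
    Val  : Set
    one  : Val
    _⊕_  : Val → Val → Val
    _⊗_  : Val → Val → Val
    _⊖_  : Val → Val → Val

module Game {n : ℕ} (E : Fin n → Fin n → Set) (Ar : Arith)
            (p T : Fin n → Arith.Val Ar) where
  open Arith Ar

  N : Fin n → Fin n → Set
  N v w = (w ≡ v) ⊎ E v w

  ChaseEq : Fin n → Fin n → Set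
  ChaseEq v w = T v ≡ one ⊕ ((one ⊖ p v) ⊗ T w)

  -- IsChase v ws : (v ∷ ws) is a chase path starting at v
  data IsChase : Fin n → List (Fin n) → Set where
    stop : ∀ {v} → ChaseEq v v → IsChase v []
    step : ∀ {v w ws} → N v w → ChaseEq v w → IsChase w ws → IsChase v (w ∷ ws)

  pathLength : List (Fin n) → ℕ
  pathLength ws = suc (length ws)

  IsShortestChase : Fin n → List (Fin n) → Set
  IsShortestChase v ws =
    IsChase v ws × (∀ ws′ → IsChase v ws′ → pathLength ws ≤ pathLength ws′)

  ShortestChaseLength : Fin n → ℕ → Set
  ShortestChaseLength v k =
    Σ (List (Fin n)) (λ ws → IsShortestChase v ws × pathLength ws ≡ k)

-- A shortest chase path v₀ v₁ … vₘ with m ≥ 1 can be shortened neither at its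
-- head nor in its tail, and that is the whole theorem:
--   * its tail v₁ … vₘ is a shortest chase path from v₁, because prefixing any
--     shorter chase path from v₁ with the step v₀ → v₁ would give a shorter
--     chase path from v₀ (so v₁ has shortest chase length k - 1);
--   * v₁ ≠ v₀, because if v₁ = v₀ the chase equation of the first step is the
--     stopping equation T(v₀) = 1 + (1 - p_{v₀}) T(v₀), so the one-vertex path
--     (v₀) would already be a chase path, shorter than one of length ≥ 2.
-- The two lemmas are proved for an arbitrary game (graph, arithmetic, p, T);
-- the theorem unpacks a shortest chase path of length k > 1 and applies them.
module Submission where

open import Defs
open import Data.Nat using (ℕ; _<_; _∸_; s≤s)
open import Data.Nat.Properties using (≤-pred)
open import Data.Fin using (Fin)
open import Data.List using (List; []; _∷_)
open import Data.Product using (Σ; _×_; _,_)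
open import Relation.Binary.PropositionalEquality using (_≢_; refl; subst)

module ShortestChase {n : ℕ} (E : Fin n → Fin n → Set) (Ar : Arith)
                     (p T : Fin n → Arith.Val Ar) where
  open Game E Ar p T

  -- The tail of a shortest chase path is a shortest chase path from the
  -- vertex following its start: a shorter competitor could be prefixed by
  -- the first step.
  shortestTail : ∀ {v u ws} → IsShortestChase v (u ∷ ws) → IsShortestChase u ws
  shortestTail {u = u} (step v→u eqᵥ chaseᵤ , minimal) =
    chaseᵤ , λ ws′ chase′ → ≤-pred (minimal (u ∷ ws′) (step v→u eqᵥ chase′))

  -- The vertex following the start of a shortest chase path is a different
  -- vertex: otherwise the start already satisfies the stopping equation and
  -- the one-vertex path (v) would be shorter.
  successorDistinct : ∀ {v u ws} → IsShortestChase v (u ∷ ws) → u ≢ v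
  successorDistinct {v} (step _ eqᵥ _ , minimal) u≡v
    with minimal [] (stop (subst (ChaseEq v) u≡v eqᵥ))
  ... | s≤s ()

mainTheorem4 : {n : ℕ} (E : Fin n → Fin n → Set) (Ar : Arith)
    (p T : Fin n → Arith.Val Ar) (v : Fin n) (k : ℕ) →
    Game.ShortestChaseLength E Ar p T v k → 1 < k →
    Σ (Fin n) (λ u → Game.N E Ar p T v u × u ≢ v
    × Game.ShortestChaseLength E Ar p T u (k ∸ 1)
    × Σ (List (Fin n)) (λ ws → Game.IsShortestChase E Ar p T v (u ∷ ws)))
-- A path of length k > 1 has a second vertex u; it is the required successor.
mainTheorem4 E Ar p T v ._ ([] , _ , refl) (s≤s ())
mainTheorem4 E Ar p T v ._ ((u ∷ ws) , shortest@(Game.step v→u _ _ , _) , refl) _ =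
  u , v→u , successorDistinct shortest
    , (ws , shortestTail shortest , refl)
    , ws , shortest
  where open ShortestChase E Ar p T
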